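{- Let $\$z$ be a variable, and let $f, g, h, xs$ be filters such that $\$z$ does not occur in $g$, $h$, or $xs$, and let $\$x$ be a variable different from $\$z$. Then each of the following pairs of filters is equivalent (the left-hand side is a filter $\varphi(f)$ whose evaluation $\varphi(f)|^c_v$ has the shape $\sum_{x \in f|^c_v} \dots$, and the right-hand side is $f \;\mathrm{as}\; \$z \mid \varphi(\$z)$): (1) $f \mid g$ and $f \;\mathrm{as}\; \$z \mid (\$z \mid g)$; (2) $f \;\mathrm{as}\; \$x \mid g$ and $f \;\mathrm{as}\; \$z \mid (\$z \;\mathrm{as}\; \$x \mid g)$; (3) $f \circ g$ and $f \;\mathrm{as}\; \$z \mid (\$z \circ g)$, for every Cartesian operator $\circ$; (4) $f?$ and $f \;\mathrm{as}\; \$z \mid \$z?$; (5) $f \;\mathrm{and}\; g$ and $f \;\mathrm{as}\; \$z \mid (\$z \;\mathrm{and}\; g)$; (6) $f \;\mathrm{or}\; g$ and $f \;\mathrm{as}\; \$z \mid (\$z \;\mathrm{or}\; g)$; (7) $\mathrm{if}\; f \;\mathrm{then}\; g \;\mathrm{else}\; h$ and $f \;\mathrm{as}\; \$z \mid \mathrm{if}\; \$z \;\mathrm{then}\; g \;\mathrm{else}\; h$; (8) $.[f]$ and $f \;\mathrm{as}\; \$z \mid .[\$z]$; (9) for $\Phi \in \{\mathrm{reduce}, \mathrm{foreach}\}$: $\Phi\; xs \;\mathrm{as}\; \$x\,(f; g)$ and $f \;\mathrm{as}\; \$z \mid \Phi\; xs \;\mathrm{as}\; \$x\,(\$z; g)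$.
   Context: Values: $v ::= \mathrm{true} \mid \mathrm{false} \mid n \mid [v, \dots, v]$ with $n \in \mathbb{Z}$. A value result is a value or an error $\bot$. A stream is a sequence $\langle v_0, \dots, v_n\rangle$ of value results; $s_1 + s_2$ is concatenation, and $\sum_{x \in s} t(x)$ denotes the concatenation, in order, of the streams $t(x)$ for the elements $x$ of $s$. A context $c$ maps variables $\$x$ to value results; $c\{\$x \mapsto x\}$ is $c$ updated at $\$x$. Filters include: $n$, $\$x$, $.$, $.[f]$, $f?$, $f \mid g$, $f \;\mathrm{as}\; \$x \mid g$, $f \circ g$ for Cartesian operators $\circ \in \{=, \neq, <, \leq, >, \geq, +, -, *, /, \%\}$, $f \;\mathrm{and}\; g$, $f \;\mathrm{or}\; g$, $\mathrm{if}\; f \;\mathrm{then}\; g \;\mathrm{else}\; h$, and folds $\Phi\; xs \;\mathrm{as}\; \$x\,(init; f)$ with $\Phi \in \{\mathrm{reduce}, \mathrm{foreach}\}$. Each Cartesian operator $\circ$ is a fixed binary function returning a value result. Evaluation $\varphi|^c_v$ of filter $\varphi$ in context $c$ on value result $v$ yields a stream; $\varphi|^c_\bot = \langle \bot\rangle$ always, and for a value $v$: $.|^c_v = \langle v\rangle$; $n|^c_v = \langle n\rangle$; $\$x|^c_v = \langle c(\$x)\rangle$; $(f\mid g)|^c_v = \sum_{x \in f|^c_v} g|^c_x$; $(f \;\mathrm{as}\; \$x \mid g)|^c_v = \sum_{x \in f|^c_v} g|^{c\{\$x\mapsto x\}}_v$; $(f\circ g)|^c_v = \sum_{x\in f|^c_v}\sum_{y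 \in g|^c_v}\langle x\circ y\rangle$; $(f?)|^c_v = \sum_{x \in f|^c_v} (\langle\rangle$ if $x=\bot$, else $\langle x\rangle)$; $(f \;\mathrm{and}\; g)|^c_v = \sum_{x\in f|^c_v}\mathrm{ite}(x,\mathrm{false},\langle\mathrm{false}\rangle, g|^c_v)$; $(f \;\mathrm{or}\; g)|^c_v = \sum_{x\in f|^c_v}\mathrm{ite}(x,\mathrm{true},\langle\mathrm{true}\rangle, g|^c_v)$; $(\mathrm{if}\; f \;\mathrm{then}\; g \;\mathrm{else}\; h)|^c_v = \sum_{x\in f|^c_v}\mathrm{ite}(x,\mathrm{true},g|^c_v,h|^c_v)$, where $\mathrm{ite}(v,i,t,e)$ is $\langle\bot\rangle$ if $v=\bot$, $t$ if $v\neq\bot$ and $v=i$, and $e$ otherwise; $.[f]|^c_v = \sum_{i \in f|^c_v}\langle v[i]\rangle$, where $v[i] = v_i$ if $v=[v_0,\dots,v_n]$ and $0\le i<n$, and $\bot$ otherwise; $(\Phi\; xs \;\mathrm{as}\; \$x\,(init;f))|^c_v = \sum_{i \in init|^c_v}\Phi^c_i(xs|^c_v, f)$, where $\Phi^c_w(s,f)$ equals $\sum_{y \in f|^{c\{\$x\mapsto x\}}_w}\Phi^c_y(t,f)$ if $s = \langle x\rangle + t$ and $\Phi=\mathrm{reduce}$; equals $\langle w\rangle + \sum_{y \in f|^{c\{\$x\mapsto x\}}_w}\Phi^c_y(t,f)$ if $s=\langle x\rangle+t$ and $\Phi = \mathrm{foreach}$; and equals $\langle w\rangle$ if $s$ is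 empty. Two filters $f, g$ are equivalent iff $f|^c_v = g|^c_v$ for all contexts $c$ and values $v$. -}

module Defs where

open import Data.Nat using (ℕ; zero; suc; _<ᵇ_) renaming (_≟_ to _≟ℕ_)
open import Data.Integer using (ℤ; +_; -[1+_]) renaming (_≟_ to _≟ℤ_)
open import Data.Bool using (Bool; true; false; if_then_else_; _∧_; _∨_)
open import Data.List using (List; []; _∷_; [_]; _++_; concatMap; length)
open import Relation.Nullary.Decidable using (⌊_⌋)
open import Relation.Binary.PropositionalEquality using (_≡_)

data Val : Set where
  vtrue vfalse : Val
  vnum         : ℤ → Val
  varr         : List Val → Val

data Res : Set where
  err : Res
  ok  : Val → Res

Stream : Set
Stream = List Res

Var : Set
Var = ℕ

Ctx : Set
Ctx = Var → Res

_[_↦_] : Ctx → Var → Res → Ctx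
(c [ x ↦ r ]) y = if ⌊ y ≟ℕ x ⌋ then r else c y

-- Cartesian operators; their meaning (a fixed binary function returning a
-- value result) is an arbitrary parameter `op` of the semantics.
data BinOp : Set where
  oEq oNeq oLt oLe oGt oGe oAdd oSub oMul oDiv oMod : BinOp

OpSem : Set
OpSem = BinOp → Val → Val → Res

data FoldKind : Set where
  reduce foreach : FoldKind

data Filter : Set where
  num      : ℤ → Filter
  var      : Var → Filter
  dot      : Filter
  idx      : Filter → Filter
  try      : Filter → Filter
  pipe     : Filter → Filter → Filter
  bindAs   : Filter → Var → Filter → Filter
  bin      : BinOp → Filter → Filter → Filter
  and'     : Filter → Filter → Filter
  or'      : Filter → Filter → Filter
  ifte     : Filter → Filter → Filter → Filter
  fold     : FoldKind → Filter → Var → Filter → Filter → Filter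
                                                     -- Φ xs as $x (init; f)

occurs : Var → Filter → Bool
occurs z (num n) = false
occurs z (var y) = ⌊ z ≟ℕ y ⌋
occurs z dot = false
occurs z (idx f) = occurs z f
occurs z (try f) = occurs z f
occurs z (pipe f g) = occurs z f ∨ occurs z g
occurs z (bindAs f y g) = occurs z f ∨ ⌊ z ≟ℕ y ⌋ ∨ occurs z g
occurs z (bin o f g) = occurs z f ∨ occurs z g
occurs z (and' f g) = occurs z f ∨ occurs z g
occurs z (or' f g) = occurs z f ∨ occurs z g
occurs z (ifte f g h) = occurs z f ∨ occurs z g ∨ occurs z h
occurs z (fold k xs y i f) = occurs z xs ∨ ⌊ z ≟ℕ y ⌋ ∨ occurs z i ∨ occurs z f

mutual
  eqV : Val → Val → Bool
  eqV vtrue vtrue = true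
  eqV vfalse vfalse = true
  eqV (vnum m) (vnum n) = ⌊ m ≟ℤ n ⌋
  eqV (varr us) (varr vs) = eqL us vs
  eqV _ _ = false

  eqL : List Val → List Val → Bool
  eqL [] [] = true
  eqL (u ∷ us) (v ∷ vs) = eqV u v ∧ eqL us vs
  eqL _ _ = false

ite : Res → Val → Stream → Stream → Stream
ite err i t e = [ err ]
ite (ok v) i t e = if eqV v i then t else e

lookupL : List Val → ℕ → Res
lookupL [] k = err
lookupL (v ∷ vs) zero = ok v
lookupL (v ∷ vs) (suc k) = lookupL vs k

index : Val → Res → Res
index (varr vs) (ok (vnum (+ k))) = lookupL vs k
index _ _ = err

tryR : Res → Stream
tryR err = []
tryR (ok v) = [ ok v ]

appOp : OpSem → BinOp → Res → Res → Res
appOp op o (ok x) (ok y) = op o x y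
appOp op o _ _ = err

mutual
  eval : OpSem → Filter → Ctx → Res → Stream
  eval op φ c err = [ err ]
  eval op φ c (ok v) = evalV op φ c v

  evalV : OpSem → Filter → Ctx → Val → Stream
  evalV op (num n) c v = [ ok (vnum n) ]
  evalV op (var x) c v = [ c x ]
  evalV op dot c v = [ ok v ]
  evalV op (idx f) c v = concatMap (λ i → [ index v i ]) (evalV op f c v)
  evalV op (try f) c v = concatMap tryR (evalV op f c v)
  evalV op (pipe f g) c v = concatMap (λ x → eval op g c x) (evalV op f c v)
  evalV op (bindAs f x g) c v =
    concatMap (λ y → evalV op g (c [ x ↦ y ]) v) (evalV op f c v)
  evalV op (bin o f g) c v =
    concatMap (λ x → concatMap (λ y → [ appOp op o x y ]) (evalV op g c v))
              (evalV op f c v)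
  evalV op (and' f g) c v =
    concatMap (λ x → ite x vfalse [ ok vfalse ] (evalV op g c v)) (evalV op f c v)
  evalV op (or' f g) c v =
    concatMap (λ x → ite x vtrue [ ok vtrue ] (evalV op g c v)) (evalV op f c v)
  evalV op (ifte f g h) c v =
    concatMap (λ x → ite x vtrue (evalV op g c v) (evalV op h c v)) (evalV op f c v)
  evalV op (fold k xs x i f) c v =
    concatMap (λ w → foldΦ op k x f c w (evalV op xs c v)) (evalV op i c v)

  foldΦ : OpSem → FoldKind → Var → Filter → Ctx → Res → Stream → Stream
  foldΦ op k x f c w [] = [ w ]
  foldΦ op reduce x f c w (y ∷ t) =
    concatMap (λ w' → foldΦ op reduce x f c w' t) (eval op f (c [ x ↦ y ]) w)
  foldΦ op foreach x f c w (y ∷ t) =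
    w ∷ concatMap (λ w' → foldΦ op foreach x f c w' t) (eval op f (c [ x ↦ y ]) w)

Equiv : OpSem → Filter → Filter → Set
Equiv op f g = ∀ (c : Ctx) (v : Val) → evalV op f c v ≡ evalV op g c v

-- Every rewrite reduces to two facts. First, if a filter does not mention $z,
-- its evaluation cannot tell c from c{$z ↦ y}. Second, on the right-hand side
-- each output y of f is evaluated in c{$z ↦ y}, where the head $z of φ($z)
-- produces exactly ⟨y⟩; so φ($z) there computes the summand of φ(f) at y.
module Submission where

open import Defs
open import Data.Bool using (Bool; false; _∨_)
open import Data.Bool.Properties using (∨-conicalˡ; ∨-conicalʳ)
open import Data.Empty using (⊥-elim)
open import Data.List using (List; []; _∷_; [_]; concatMap)
open import Data.List.Properties using (++-identityʳ; concatMap-cong)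
open import Data.Nat using () renaming (_≟_ to _≟ℕ_)
open import Data.Product using (_×_; _,_)
open import Relation.Binary.PropositionalEquality
  using (_≡_; _≢_; _≗_; refl; sym; trans; cong; cong₂)
open import Relation.Nullary using (yes; no)
open import Relation.Nullary.Decidable using (⌊_⌋)

∨-false : ∀ (a : Bool) {b} → a ∨ b ≡ false → a ≡ false × b ≡ false
∨-false a {b} e = ∨-conicalˡ a b e , ∨-conicalʳ a b e

concatMap-cong₂ : ∀ {A B : Set} {f g : A → List B} {xs ys : List A} →
                  f ≗ g → xs ≡ ys → concatMap f xs ≡ concatMap g ys
concatMap-cong₂ {xs = xs} f≗g refl = concatMap-cong f≗g xs

concatMap-[-] : ∀ {A B : Set} (F : A → List B) (a : A) → concatMap F [ a ] ≡ F a
concatMap-[-] F a = ++-identityʳ (F a)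

var-fresh⇒≢ : ∀ z y → occurs z (var y) ≡ false → y ≢ z
var-fresh⇒≢ z y fresh refl with z ≟ℕ z
var-fresh⇒≢ z y () refl | yes _
... | no z≢z = z≢z refl

AgreeExcept : Var → Ctx → Ctx → Set
AgreeExcept z c c' = ∀ w → w ≢ z → c w ≡ c' w

update-self : ∀ (c : Ctx) z r → (c [ z ↦ r ]) z ≡ r
update-self c z r with z ≟ℕ z
... | yes _ = refl
... | no z≢z = ⊥-elim (z≢z refl)

update-agreeExcept : ∀ (c : Ctx) z r → AgreeExcept z (c [ z ↦ r ]) c
update-agreeExcept c z r w w≢z with w ≟ℕ z
... | yes w≡z = ⊥-elim (w≢z w≡z)
... | no _ = refl

update-resp-agreeExcept : ∀ {z c c'} x r → AgreeExcept z c c' →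
                          AgreeExcept z (c [ x ↦ r ]) (c' [ x ↦ r ])
update-resp-agreeExcept x r agree w w≢z with w ≟ℕ x
... | yes _ = refl
... | no _ = agree w w≢z

module _ (op : OpSem) {z : Var} where

  mutual
    evalV-fresh : ∀ {c c'} → AgreeExcept z c c' → ∀ φ v → occurs z φ ≡ false →
                  evalV op φ c v ≡ evalV op φ c' v
    evalV-fresh agree (num n) v fresh = refl
    evalV-fresh agree (var y) v fresh = cong [_] (agree y (var-fresh⇒≢ z y fresh))
    evalV-fresh agree dot v fresh = refl
    evalV-fresh agree (idx f) v fresh = cong (concatMap _) (evalV-fresh agree f v fresh)
    evalV-fresh agree (try f) v fresh = cong (concatMap _) (evalV-fresh agree f v fresh)
    evalV-fresh agree (pipe f g) v fresh
      with fresh-f , fresh-g ← ∨-false (occurs z f) fresh =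
      concatMap-cong₂ (λ r → eval-fresh agree g r fresh-g)
                      (evalV-fresh agree f v fresh-f)
    evalV-fresh agree (bindAs f y g) v fresh
      with fresh-f , fresh-yg ← ∨-false (occurs z f) fresh
      with _ , fresh-g ← ∨-false ⌊ z ≟ℕ y ⌋ fresh-yg =
      concatMap-cong₂
        (λ r → evalV-fresh (update-resp-agreeExcept y r agree) g v fresh-g)
        (evalV-fresh agree f v fresh-f)
    evalV-fresh agree (bin o f g) v fresh
      with fresh-f , fresh-g ← ∨-false (occurs z f) fresh =
      concatMap-cong₂ (λ _ → cong (concatMap _) (evalV-fresh agree g v fresh-g))
                      (evalV-fresh agree f v fresh-f)
    evalV-fresh agree (and' f g) v fresh
      with fresh-f , fresh-g ← ∨-false (occurs z f) fresh =
      concatMap-cong₂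
        (λ r → cong (ite r vfalse [ ok vfalse ]) (evalV-fresh agree g v fresh-g))
        (evalV-fresh agree f v fresh-f)
    evalV-fresh agree (or' f g) v fresh
      with fresh-f , fresh-g ← ∨-false (occurs z f) fresh =
      concatMap-cong₂
        (λ r → cong (ite r vtrue [ ok vtrue ]) (evalV-fresh agree g v fresh-g))
        (evalV-fresh agree f v fresh-f)
    evalV-fresh agree (ifte f g h) v fresh
      with fresh-f , fresh-gh ← ∨-false (occurs z f) fresh
      with fresh-g , fresh-h ← ∨-false (occurs z g) fresh-gh =
      concatMap-cong₂
        (λ r → cong₂ (ite r vtrue) (evalV-fresh agree g v fresh-g)
                                   (evalV-fresh agree h v fresh-h))
        (evalV-fresh agree f v fresh-f)
    evalV-fresh agree (fold k xs y i f) v fresh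
      with fresh-xs , fresh-yif ← ∨-false (occurs z xs) fresh
      with _ , fresh-if ← ∨-false ⌊ z ≟ℕ y ⌋ fresh-yif
      with fresh-i , fresh-f ← ∨-false (occurs z i) fresh-if =
      concatMap-cong₂
        (λ w → foldΦ-fresh agree k y f w (evalV-fresh agree xs v fresh-xs) fresh-f)
        (evalV-fresh agree i v fresh-i)

    eval-fresh : ∀ {c c'} → AgreeExcept z c c' → ∀ φ r → occurs z φ ≡ false →
                 eval op φ c r ≡ eval op φ c' r
    eval-fresh agree φ err fresh = refl
    eval-fresh agree φ (ok v) fresh = evalV-fresh agree φ v fresh

    foldΦ-fresh : ∀ {c c'} → AgreeExcept z c c' → ∀ k y f w {s s'} → s ≡ s' →
                  occurs z f ≡ false → foldΦ op k y f c w s ≡ foldΦ op k y f c' w s'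
    foldΦ-fresh agree k y f w {[]} refl fresh = refl
    foldΦ-fresh agree reduce y f w {r ∷ t} refl fresh =
      concatMap-cong₂ (λ w' → foldΦ-fresh agree reduce y f w' {t} refl fresh)
                      (eval-fresh (update-resp-agreeExcept y r agree) f w fresh)
    foldΦ-fresh agree foreach y f w {r ∷ t} refl fresh =
      cong (w ∷_)
        (concatMap-cong₂ (λ w' → foldΦ-fresh agree foreach y f w' {t} refl fresh)
                         (eval-fresh (update-resp-agreeExcept y r agree) f w fresh))

module HeadVar (op : OpSem) (z : Var) where

  concatMap-var-update : ∀ c y (F : Res → Stream) → concatMap F [ (c [ z ↦ y ]) z ] ≡ F y
  concatMap-var-update c y F = trans (concatMap-[-] F _) (cong F (update-self c z y))

  evalV-fresh-update : ∀ φ → occurs z φ ≡ false → ∀ c y v →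
                       evalV op φ (c [ z ↦ y ]) v ≡ evalV op φ c v
  evalV-fresh-update φ fresh c y v = evalV-fresh op (update-agreeExcept c z y) φ v fresh

  pipe-var-update : ∀ g → occurs z g ≡ false → ∀ c v y →
                    evalV op (pipe (var z) g) (c [ z ↦ y ]) v ≡ eval op g c y
  pipe-var-update g fresh c v y =
    trans (concatMap-var-update c y (eval op g (c [ z ↦ y ])))
          (eval-fresh op (update-agreeExcept c z y) g y fresh)

  bindAs-var-update : ∀ x g → occurs z g ≡ false → ∀ c v y →
                      evalV op (bindAs (var z) x g) (c [ z ↦ y ]) v ≡ evalV op g (c [ x ↦ y ]) v
  bindAs-var-update x g fresh c v y =
    trans (concatMap-var-update c y (λ r → evalV op g ((c [ z ↦ y ]) [ x ↦ r ]) v))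
          (evalV-fresh op (update-resp-agreeExcept x y (update-agreeExcept c z y))
                       g v fresh)

  bin-var-update : ∀ o g → occurs z g ≡ false → ∀ c v y →
                   evalV op (bin o (var z) g) (c [ z ↦ y ]) v
                   ≡ concatMap (λ r → [ appOp op o y r ]) (evalV op g c v)
  bin-var-update o g fresh c v y =
    trans (concatMap-var-update c y
            (λ r → concatMap (λ q → [ appOp op o r q ]) (evalV op g (c [ z ↦ y ]) v)))
          (cong (concatMap (λ r → [ appOp op o y r ])) (evalV-fresh-update g fresh c y v))

  try-var-update : ∀ c v y → evalV op (try (var z)) (c [ z ↦ y ]) v ≡ tryR y
  try-var-update c v y = concatMap-var-update c y tryR

  and-var-update : ∀ g → occurs z g ≡ false → ∀ c v y →
                   evalV op (and' (var z) g) (c [ z ↦ y ]) v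
                   ≡ ite y vfalse [ ok vfalse ] (evalV op g c v)
  and-var-update g fresh c v y =
    trans (concatMap-var-update c y
            (λ r → ite r vfalse [ ok vfalse ] (evalV op g (c [ z ↦ y ]) v)))
          (cong (ite y vfalse [ ok vfalse ]) (evalV-fresh-update g fresh c y v))

  or-var-update : ∀ g → occurs z g ≡ false → ∀ c v y →
                  evalV op (or' (var z) g) (c [ z ↦ y ]) v
                  ≡ ite y vtrue [ ok vtrue ] (evalV op g c v)
  or-var-update g fresh c v y =
    trans (concatMap-var-update c y
            (λ r → ite r vtrue [ ok vtrue ] (evalV op g (c [ z ↦ y ]) v)))
          (cong (ite y vtrue [ ok vtrue ]) (evalV-fresh-update g fresh c y v))

  ifte-var-update : ∀ g h → occurs z g ≡ false → occurs z h ≡ false → ∀ c v y →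
                    evalV op (ifte (var z) g h) (c [ z ↦ y ]) v
                    ≡ ite y vtrue (evalV op g c v) (evalV op h c v)
  ifte-var-update g h fresh-g fresh-h c v y =
    trans (concatMap-var-update c y
            (λ r → ite r vtrue (evalV op g (c [ z ↦ y ]) v) (evalV op h (c [ z ↦ y ]) v)))
          (cong₂ (ite y vtrue) (evalV-fresh-update g fresh-g c y v)
                               (evalV-fresh-update h fresh-h c y v))

  idx-var-update : ∀ c v y → evalV op (idx (var z)) (c [ z ↦ y ]) v ≡ [ index v y ]
  idx-var-update c v y = concatMap-var-update c y (λ i → [ index v i ])

  fold-var-update : ∀ Φ x xs g → occurs z xs ≡ false → occurs z g ≡ false → ∀ c v y →
                    evalV op (fold Φ xs x (var z) g) (c [ z ↦ y ]) v
                    ≡ foldΦ op Φ x g c y (evalV op xs c v)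
  fold-var-update Φ x xs g fresh-xs fresh-g c v y =
    trans (concatMap-var-update c y
            (λ w → foldΦ op Φ x g (c [ z ↦ y ]) w (evalV op xs (c [ z ↦ y ]) v)))
          (foldΦ-fresh op (update-agreeExcept c z y) Φ x g y
                       (evalV-fresh-update xs fresh-xs c y v) fresh-g)

  concatMap≡bindAs : ∀ f ψ {K : Ctx → Val → Res → Stream} →
                     (∀ c v y → evalV op ψ (c [ z ↦ y ]) v ≡ K c v y) →
                     ∀ c v → concatMap (K c v) (evalV op f c v) ≡ evalV op (bindAs f z ψ) c v
  concatMap≡bindAs f ψ ψ≡K c v = concatMap-cong (λ y → sym (ψ≡K c v y)) (evalV op f c v)

mainTheorem1 : (op : OpSem) (z x : Var) (f g h xs : Filter) →
    occurs z g ≡ false → occurs z h ≡ false → occurs z xs ≡ false → x ≢ z →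
    Equiv op (pipe f g) (bindAs f z (pipe (var z) g))
    × Equiv op (bindAs f x g) (bindAs f z (bindAs (var z) x g))
    × (∀ (o : BinOp) → Equiv op (bin o f g) (bindAs f z (bin o (var z) g)))
    × Equiv op (try f) (bindAs f z (try (var z)))
    × Equiv op (and' f g) (bindAs f z (and' (var z) g))
    × Equiv op (or' f g) (bindAs f z (or' (var z) g))
    × Equiv op (ifte f g h) (bindAs f z (ifte (var z) g h))
    × Equiv op (idx f) (bindAs f z (idx (var z)))
    × (∀ (Φ : FoldKind) →
        Equiv op (fold Φ xs x f g) (bindAs f z (fold Φ xs x (var z) g)))
mainTheorem1 op z x f g h xs fresh-g fresh-h fresh-xs _ =
    concatMap≡bindAs f (pipe (var z) g) (pipe-var-update g fresh-g)
  , concatMap≡bindAs f (bindAs (var z) x g) (bindAs-var-update x g fresh-g)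
  , (λ o → concatMap≡bindAs f (bin o (var z) g) (bin-var-update o g fresh-g))
  , concatMap≡bindAs f (try (var z)) try-var-update
  , concatMap≡bindAs f (and' (var z) g) (and-var-update g fresh-g)
  , concatMap≡bindAs f (or' (var z) g) (or-var-update g fresh-g)
  , concatMap≡bindAs f (ifte (var z) g h) (ifte-var-update g h fresh-g fresh-h)
  , concatMap≡bindAs f (idx (var z)) idx-var-update
  , (λ Φ → concatMap≡bindAs f (fold Φ xs x (var z) g)
                              (fold-var-update Φ x xs g fresh-xs fresh-g))
  where open HeadVar op z
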